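{- Let $\lambda$ be a partition (with $\lambda_i\ge i$ for all $i$) whose GJW sequence is the concatenation $(a,0,b)$ of a sequence $a$, a single entry $0$, and a sequence $b$. Let $\lambda^1$ and $\lambda^2$ be the partitions whose GJW sequences are $a$ and $b$ respectively. Then the rook poset $P_\lambda$ is isomorphic to the product poset $P_{\lambda^1}\times P_{\lambda^2}$.
   Context: A partition $\lambda=(\lambda_1\le\cdots\le\lambda_n)$ of positive integers with $\lambda_i\ge i$; its GJW sequence is $(\lambda_i-i)_{i=1}^n$, and conversely a sequence $(g_1,\dots,g_m)$ of nonnegative integers with $g_{i+1}\ge g_i-1$ is the GJW sequence of the partition $(g_i+i)_{i=1}^m$. Ferrers board of $\lambda$: cells $(i,j)$, row $i$ from the bottom, $1\le j\le\lambda_i$. A maximal rook placement is a sequence $x=(x_1,\dots,x_n)$ of distinct integers with $1\le x_i\le\lambda_i$. The rook poset $P_\lambda$: $x\le y$ iff for every $j$ the increasingly sorted list of $\{x_1,\dots,x_j\}$ is entrywise $\le$ that of $\{y_1,\dots,y_j\}$. The rook poset of the empty partition is the one-element poset. -}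

module Defs where

open import Data.Nat using (ℕ; zero; suc; _+_; _∸_; _≤_)
open import Data.Nat.Properties using (≤-decTotalOrder)
open import Data.List using (List; []; _∷_; length; zipWith; applyUpTo; take)
open import Data.List.Relation.Binary.Pointwise using (Pointwise)
open import Data.List.Relation.Unary.Linked using (Linked)
open import Data.List.Relation.Unary.AllPairs using (AllPairs)
open import Data.Product using (_×_; _,_; ∃)
open import Data.Product.Relation.Binary.Pointwise.NonDependent as PW× using ()
open import Relation.Binary.PropositionalEquality using (_≡_; _≢_)
open import Relation.Binary.Morphism.Structures using (IsOrderIsomorphism)
import Data.List.Sort.InsertionSort.Base as ISort

sortℕ : List ℕ → List ℕ
sortℕ = ISort.sort ≤-decTotalOrder

oneTo : ℕ → List ℕ
oneTo n = applyUpTo suc n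

-- A partition λ = (λ₁ ≤ ... ≤ λₙ) (a list, weakly increasing) with λᵢ ≥ i
-- (positivity of the parts follows from λᵢ ≥ i ≥ 1).
IsPartition : List ℕ → Set
IsPartition lam = Linked _≤_ lam × Pointwise _≤_ (oneTo (length lam)) lam

gjw : List ℕ → List ℕ
gjw lam = zipWith _∸_ lam (oneTo (length lam))

fromGJW : List ℕ → List ℕ
fromGJW g = zipWith _+_ g (oneTo (length g))

-- Maximal rook placements on the Ferrers board of λ:
-- sequences (x₁,...,xₙ) of distinct integers with 1 ≤ xᵢ ≤ λᵢ.
record Rook (lam : List ℕ) : Set where
  constructor rook
  field
    pos      : List ℕ
    bounds   : Pointwise (λ x l → 1 ≤ x × x ≤ l) pos lam
    distinct : AllPairs _≢_ pos
open Rook public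

_≈R_ : ∀ {lam} → Rook lam → Rook lam → Set
x ≈R y = pos x ≡ pos y

_≤R_ : ∀ {lam} → Rook lam → Rook lam → Set
x ≤R y = ∀ (j : ℕ) → Pointwise _≤_ (sortℕ (take j (pos x))) (sortℕ (take j (pos y)))

RookIsoProduct : List ℕ → List ℕ → List ℕ → Set
RookIsoProduct lam mu nu =
  ∃ λ (f : Rook lam → Rook mu × Rook nu) →
    IsOrderIsomorphism _≈R_ (PW×.Pointwise _≈R_ _≈R_)
                       _≤R_ (PW×.Pointwise _≤R_ _≤R_) f

-- Let K = |λ¹| + 1, so that λ = λ¹ ++ K ∷ (K + λ²) entrywise. Rows 1..K have length at most K,
-- so in a maximal rook placement the rooks of rows 1..K occupy exactly the columns 1..K and all
-- later rooks lie beyond column K. Keeping the rooks below row K and shifting those above row K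
-- left by K is thus a bijection onto P_λ¹ × P_λ²; the rook of row K is recovered as the one
-- column of 1..K left free. Prefixes of length < K only see the lower part, while the sorted
-- prefix of length K + i is 1..K followed by K + the sorted i-prefix of the upper part, so the
-- rook order becomes the product order.
module Submission where

open import Defs
open import Data.Nat using (ℕ; zero; suc; _+_; _∸_; _≤_; _<_; _⊓_; z≤n; s≤s; _≤?_)
open import Data.Nat.Properties
open import Algebra.Properties.CommutativeSemigroup +-commutativeSemigroup using (x∙yz≈y∙xz)
open import Data.List using (List; []; _∷_; _++_; _∷ʳ_; [_]; length; take; map; zipWith; applyUpTo)
open import Data.List.Properties using (∷-injectiveˡ; ∷-injectiveʳ; ∷ʳ-++; length-++; length-applyUpTo; map-injective; take-map)
open import Data.List.Relation.Binary.Pointwise as Pointwise using (Pointwise; []; _∷_; Pointwise-length)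
open import Data.List.Relation.Unary.All as All using (All; []; _∷_)
import Data.List.Relation.Unary.All.Properties as All
open import Data.List.Relation.Unary.Any using (here; there)
open import Data.List.Relation.Unary.AllPairs using (AllPairs; []; _∷_)
open import Data.List.Relation.Unary.Linked using (Linked)
import Data.List.Relation.Unary.Linked.Properties as Linked
import Data.List.Relation.Unary.AllPairs.Properties as AllPairs
open import Data.List.Relation.Unary.Unique.Propositional using (Unique)
import Data.List.Relation.Unary.Unique.Propositional.Properties as Unique
import Data.List.Relation.Unary.Sorted.TotalOrder.Properties as Sorted
open import Data.List.Membership.Propositional using (_∈_; _∉_; find)
open import Data.List.Membership.Propositional.Properties using (∈-∃++; ∈-applyUpTo⁺; ∈-applyUpTo⁻)
open import Data.List.Membership.Propositional.Properties.WithK using (unique∧set⇒bag)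
import Data.List.Membership.DecPropositional as DecMembership
open import Data.List.Relation.Binary.Subset.Propositional using (_⊆_)
open import Data.List.Relation.Binary.Disjoint.Propositional using (Disjoint)
open import Data.List.Relation.Binary.Permutation.Propositional using (_↭_; ↭-sym; ↭-trans; ↭⇒↭ₛ)
open import Data.List.Relation.Binary.Permutation.Propositional.Properties using (shift; ∈-resp-↭; ↭-length; ↭-singleton-inv; All-resp-↭; ++⁺; map⁺)
open import Data.List.Relation.Binary.BagAndSetEquality using (↭⇒∼bag; ∼bag⇒↭; drop-cons)
open import Data.List.Sort.InsertionSort.Properties ≤-decTotalOrder using (sort-↭; sort-↗)
open import Data.Product using (_×_; _,_; ∃; proj₁; proj₂; map₁; map₂)
open import Data.Product.Function.NonDependent.Propositional using (_×-⇔_)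
open import Function using (_∘_)
open import Function.Bundles using (_⇔_; mk⇔; Equivalence)
open import Function.Construct.Identity using (⇔-id)
open import Function.Construct.Composition using (_⇔-∘_)
open import Level using (Level)
open import Relation.Binary.Definitions using (DecidableEquality)
open import Relation.Binary.PropositionalEquality using (_≡_; refl; sym; trans; cong; cong₂; subst; subst₂; module ≡-Reasoning)
open import Relation.Nullary using (yes; no; contradiction)

open Equivalence using (to; from)

private
  variable
    a ℓ : Level
    A : Set a

++-injective : ∀ {xs xs′ ys ys′ : List A} → length xs ≡ length xs′ →
               xs ++ ys ≡ xs′ ++ ys′ → xs ≡ xs′ × ys ≡ ys′
++-injective {xs = []}    {[]}      _   eq = refl , eq
++-injective {xs = _ ∷ _} {_ ∷ _} len eq =
  map₁ (cong₂ _∷_ (∷-injectiveˡ eq)) (++-injective (suc-injective len) (∷-injectiveʳ eq))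

pieces-injective : ∀ K {xs xs′ zs zs′ : List ℕ} {v v′} → length xs ≡ length xs′ →
                   xs ++ v ∷ map (K +_) zs ≡ xs′ ++ v′ ∷ map (K +_) zs′ → xs ≡ xs′ × zs ≡ zs′
pieces-injective K |xs|≡|xs′| eq =
  map₂ (map-injective (+-cancelˡ-≡ K _ _) ∘ ∷-injectiveʳ) (++-injective |xs|≡|xs′| eq)

take-⊓-length-++ : ∀ j (xs ys : List A) → take (j ⊓ length xs) (xs ++ ys) ≡ take j xs
take-⊓-length-++ zero    xs       ys = refl
take-⊓-length-++ (suc j) []       ys = refl
take-⊓-length-++ (suc j) (x ∷ xs) ys = cong (x ∷_) (take-⊓-length-++ j xs ys)

take-suc-length-++ : ∀ (xs : List A) y ys i →
                     take (suc (length xs) + i) (xs ++ y ∷ ys) ≡ (xs ∷ʳ y) ++ take i ys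
take-suc-length-++ []       y ys i = refl
take-suc-length-++ (x ∷ xs) y ys i = cong (x ∷_) (take-suc-length-++ xs y ys i)

AllPairs-++⁻ : ∀ {R : A → A → Set ℓ} xs {ys} → AllPairs R (xs ++ ys) →
               AllPairs R xs × AllPairs R ys × All (λ x → All (R x) ys) xs
AllPairs-++⁻ []       rs          = [] , rs , []
AllPairs-++⁻ (x ∷ xs) (rx ∷ rxs) with AllPairs-++⁻ xs rxs
... | rs₁ , rs₂ , rs₁₂ = All.++⁻ˡ xs rx ∷ rs₁ , rs₂ , All.++⁻ʳ xs rx ∷ rs₁₂

Pointwise-++⁻ʳ : ∀ {B : Set a} {R : A → B → Set ℓ} {zs} ys {ws} → Pointwise R zs (ys ++ ws) →
                 ∃ λ xs → ∃ λ vs → zs ≡ xs ++ vs × Pointwise R xs ys × Pointwise R vs ws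
Pointwise-++⁻ʳ []       rs       = [] , _ , refl , [] , rs
Pointwise-++⁻ʳ (y ∷ ys) (r ∷ rs) with Pointwise-++⁻ʳ ys rs
... | xs , vs , refl , rs₁ , rs₂ = _ ∷ xs , vs , refl , r ∷ rs₁ , rs₂

Linked-++-∷⇒All≤ : ∀ xs {y ys} → Linked _≤_ (xs ++ y ∷ ys) → All (_≤ y) xs
Linked-++-∷⇒All≤ xs xs++y∷ys↗ =
  All.map All.head (proj₂ (proj₂ (AllPairs-++⁻ xs (Linked.Linked⇒AllPairs ≤-trans xs++y∷ys↗))))

++-cancelˡ-↭ : ∀ (xs : List A) {ys zs} → xs ++ ys ↭ xs ++ zs → ys ↭ zs
++-cancelˡ-↭ []       p = p
++-cancelˡ-↭ (x ∷ xs) p = ++-cancelˡ-↭ xs (∼bag⇒↭ (drop-cons (↭⇒∼bag p)))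

∷ʳ-↭-injectiveʳ : ∀ (xs : List A) {x y} → xs ∷ʳ x ↭ xs ∷ʳ y → x ≡ y
∷ʳ-↭-injectiveʳ xs p = ∷-injectiveˡ (↭-singleton-inv (++-cancelˡ-↭ xs p))

Unique-++⇒All∉ : ∀ {xs ys zs : List A} → Unique (xs ++ ys) → xs ↭ zs → All (_∉ zs) ys
Unique-++⇒All∉ {xs = xs} xs++ys! xs↭zs = All.tabulate λ y∈ys y∈zs →
  All.lookup (All.lookup (proj₂ (proj₂ (AllPairs-++⁻ xs xs++ys!))) (∈-resp-↭ (↭-sym xs↭zs) y∈zs)) y∈ys refl

Unique-⊆⇒length≤ : ∀ {xs ys : List A} → Unique xs → xs ⊆ ys → length xs ≤ length ys
Unique-⊆⇒length≤ {xs = []}     _             _         = z≤n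
Unique-⊆⇒length≤ {xs = x ∷ xs} (x∉xs ∷ xs!) x∷xs⊆ys with ∈-∃++ (x∷xs⊆ys (here refl))
... | ys₁ , ys₂ , refl = begin
  suc (length xs)              ≤⟨ s≤s (Unique-⊆⇒length≤ xs! xs⊆ys₁++ys₂) ⟩
  suc (length (ys₁ ++ ys₂))    ≡⟨ ↭-length (shift x ys₁ ys₂) ⟨
  length (ys₁ ++ [ x ] ++ ys₂) ∎
  where
  open ≤-Reasoning
  xs⊆ys₁++ys₂ : xs ⊆ ys₁ ++ ys₂
  xs⊆ys₁++ys₂ z∈xs with ∈-resp-↭ (shift x ys₁ ys₂) (x∷xs⊆ys (there z∈xs))
  ... | here refl = contradiction refl (All.lookup x∉xs z∈xs)
  ... | there z∈  = z∈

module _ (_≟_ : DecidableEquality A) where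
  open DecMembership _≟_ using (_∈?_)

  Unique-⊆-length≥⇒⊇ : ∀ {xs ys : List A} → Unique xs → xs ⊆ ys → length ys ≤ length xs → ys ⊆ xs
  Unique-⊆-length≥⇒⊇ {xs} xs! xs⊆ys |ys|≤|xs| {y} y∈ys with y ∈? xs
  ... | yes y∈xs = y∈xs
  ... | no  y∉xs = contradiction
    (Unique-⊆⇒length≤ (All.¬Any⇒All¬ xs y∉xs ∷ xs!) λ { (here refl) → y∈ys ; (there z∈xs) → xs⊆ys z∈xs })
    (≤⇒≯ |ys|≤|xs|)

  Unique-⊆-length≥⇒↭ : ∀ {xs ys : List A} → Unique xs → Unique ys → xs ⊆ ys → length ys ≤ length xs → xs ↭ ys
  Unique-⊆-length≥⇒↭ xs! ys! xs⊆ys |ys|≤|xs| =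
    ∼bag⇒↭ (unique∧set⇒bag xs! ys! (mk⇔ xs⊆ys (Unique-⊆-length≥⇒⊇ xs! xs⊆ys |ys|≤|xs|)))

  length<⇒∃∉ : ∀ {xs ys : List A} → Unique ys → length xs < length ys → ∃ λ y → y ∈ ys × y ∉ xs
  length<⇒∃∉ {xs} {ys} ys! |xs|<|ys| with All.all? (_∈? xs) ys
  ... | yes ys⊆xs = contradiction (Unique-⊆⇒length≤ ys! (All.lookup ys⊆xs)) (<⇒≱ |xs|<|ys|)
  ... | no  ys⊈xs = find (All.¬All⇒Any¬ (_∈? xs) ys ys⊈xs)

infix 4 1≤_≤_

1≤_≤_ : ℕ → ℕ → Set
1≤ x ≤ n = 1 ≤ x × x ≤ n

length-pos : ∀ {lam} (r : Rook lam) → length (pos r) ≡ length lam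
length-pos r = Pointwise-length (bounds r)

∈-oneTo⁺ : ∀ {w n} → 1≤ w ≤ n → w ∈ oneTo n
∈-oneTo⁺ {suc w} (_ , w<n) = ∈-applyUpTo⁺ suc w<n

∈-oneTo⁻ : ∀ {w n} → w ∈ oneTo n → 1≤ w ≤ n
∈-oneTo⁻ w∈ with ∈-applyUpTo⁻ suc w∈
... | _ , i<n , refl = s≤s z≤n , i<n

∉-oneTo⇒> : ∀ {w n} → 1 ≤ w → w ∉ oneTo n → n < w
∉-oneTo⇒> {w} {n} 1≤w w∉ with w ≤? n
... | yes w≤n = contradiction (∈-oneTo⁺ (1≤w , w≤n)) w∉
... | no  w≰n = ≰⇒> w≰n

oneTo-unique : ∀ n → Unique (oneTo n)
oneTo-unique n = Unique.applyUpTo⁺₁ suc n (λ i<j _ → <⇒≢ (s≤s i<j))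

oneTo-sorted : ∀ n → Linked _≤_ (oneTo n)
oneTo-sorted n = Sorted.applyUpTo⁺₂ ≤-totalOrder suc n (λ i → n≤1+n (suc i))

columns≤ : ∀ {n xs ys} → Pointwise 1≤_≤_ xs ys → All (_≤ n) ys → All (1≤_≤ n) xs
columns≤ []                  []          = []
columns≤ ((1≤x , x≤y) ∷ xys) (y≤n ∷ ys≤n) = (1≤x , ≤-trans x≤y y≤n) ∷ columns≤ xys ys≤n

shift-up : ∀ K {xs ys} → Pointwise 1≤_≤_ xs ys → Pointwise 1≤_≤_ (map (K +_) xs) (map (K +_) ys)
shift-up K xys = Pointwise.map⁺ _ _ (Pointwise.map (λ (1≤x , x≤y) → ≤-trans 1≤x (m≤n+m _ K) , +-monoʳ-≤ K x≤y) xys)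

shift-up-above : ∀ K {xs ys} → Pointwise 1≤_≤_ xs ys → All (K <_) (map (K +_) xs)
shift-up-above K []               = []
shift-up-above K ((1≤x , _) ∷ xys) = m<m+n K 1≤x ∷ shift-up-above K xys

shift-down : ∀ {K xs} ys → All (_∉ oneTo K) xs → Pointwise 1≤_≤_ xs (map (K +_) ys) →
             ∃ λ zs → xs ≡ map (K +_) zs × Pointwise 1≤_≤_ zs ys
shift-down []       []          []                    = [] , refl , []
shift-down {K} {x ∷ _} (y ∷ ys) (x∉ ∷ xs∉) ((1≤x , x≤K+y) ∷ xys) with shift-down ys xs∉ xys
... | zs , refl , zys =
  x ∸ K ∷ zs ,
  cong (_∷ map (K +_) zs) (sym (m+[n∸m]≡n (<⇒≤ K<x))) ,
  (m<n⇒0<n∸m K<x , m≤n+o⇒m∸n≤o x K x≤K+y) ∷ zys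
  where
  K<x : K < x
  K<x = ∉-oneTo⇒> 1≤x x∉

infix 4 _≪_

_≪_ : List ℕ → List ℕ → Set
xs ≪ ys = All (λ x → All (x ≤_) ys) xs

≤-<⇒≪ : ∀ {n xs ys} → All (_≤ n) xs → All (n <_) ys → xs ≪ ys
≤-<⇒≪ xs≤n n<ys = All.map (λ x≤n → All.map (λ n<y → ≤-trans x≤n (<⇒≤ n<y)) n<ys) xs≤n

sorted-↭⇒sort≡ : ∀ {xs ys} → Linked _≤_ ys → xs ↭ ys → sortℕ xs ≡ ys
sorted-↭⇒sort≡ {xs} ys↗ xs↭ys =
  Pointwise.Pointwise-≡⇒≡ (Sorted.↗↭↗⇒≋ ≤-totalOrder (sort-↗ xs) ys↗ (↭⇒↭ₛ (↭-trans (sort-↭ xs) xs↭ys)))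

sort-++ : ∀ xs ys → xs ≪ ys → sortℕ (xs ++ ys) ≡ sortℕ xs ++ sortℕ ys
sort-++ xs ys xs≪ys = sorted-↭⇒sort≡ sorted (↭-sym (++⁺ (sort-↭ xs) (sort-↭ ys)))
  where
  sort≪sort : sortℕ xs ≪ sortℕ ys
  sort≪sort = All-resp-↭ (↭-sym (sort-↭ xs)) (All.map (All-resp-↭ (↭-sym (sort-↭ ys))) xs≪ys)
  sorted : Linked _≤_ (sortℕ xs ++ sortℕ ys)
  sorted = Linked.AllPairs⇒Linked (AllPairs.++⁺ (Linked.Linked⇒AllPairs ≤-trans (sort-↗ xs))
                                                (Linked.Linked⇒AllPairs ≤-trans (sort-↗ ys)) sort≪sort)

sort-map : ∀ {f : ℕ → ℕ} → (∀ {x y} → x ≤ y → f x ≤ f y) → ∀ xs → sortℕ (map f xs) ≡ map f (sortℕ xs)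
sort-map {f} f-mono xs =
  sorted-↭⇒sort≡ (Sorted.map⁺ ≤-totalOrder ≤-totalOrder f-mono (sort-↗ xs)) (map⁺ f (↭-sym (sort-↭ xs)))

infix 4 _≼_

_≼_ : List ℕ → List ℕ → Set
xs ≼ ys = ∀ j → Pointwise _≤_ (sortℕ (take j xs)) (sortℕ (take j ys))

≼-map : ∀ {f : ℕ → ℕ} → (∀ {x y} → x ≤ y → f x ≤ f y) → (∀ {x y} → f x ≤ f y → x ≤ y) →
        ∀ {xs ys} → map f xs ≼ map f ys ⇔ xs ≼ ys
≼-map {f} f-mono f-reflects {xs} {ys} = mk⇔
  (λ fxs≼fys j → Pointwise.map f-reflects (Pointwise.map⁻ f f
    (subst₂ (Pointwise _≤_) (sort-take-map xs j) (sort-take-map ys j) (fxs≼fys j))))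
  (λ xs≼ys j → subst₂ (Pointwise _≤_) (sym (sort-take-map xs j)) (sym (sort-take-map ys j))
    (Pointwise.map⁺ f f (Pointwise.map f-mono (xs≼ys j))))
  where
  sort-take-map : ∀ zs j → sortℕ (take j (map f zs)) ≡ map f (sortℕ (take j zs))
  sort-take-map zs j = trans (cong sortℕ (take-map j zs)) (sort-map f-mono (take j zs))

-- Lying below all later entries, the first k + 1 entries form the same sorted block at the
-- start of every longer sorted prefix, so that block cancels.
≼-split : ∀ {k v v′} {xs xs′ ys ys′ : List ℕ} → length xs ≡ k → length xs′ ≡ k →
          sortℕ (xs ∷ʳ v) ≡ sortℕ (xs′ ∷ʳ v′) → xs ∷ʳ v ≪ ys → xs′ ∷ʳ v′ ≪ ys′ →
          xs ++ v ∷ ys ≼ xs′ ++ v′ ∷ ys′ ⇔ (xs ≼ xs′ × ys ≼ ys′)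
≼-split {k} {v} {v′} {xs} {xs′} {ys} {ys′} |xs| |xs′| same xs≪ys xs′≪ys′ = mk⇔ split join
  where
  P Q : List ℕ
  P = xs ++ v ∷ ys
  Q = xs′ ++ v′ ∷ ys′

  low : ∀ {zs w ws} → length zs ≡ k → ∀ j → sortℕ (take (j ⊓ k) (zs ++ w ∷ ws)) ≡ sortℕ (take j zs)
  low refl j = cong sortℕ (take-⊓-length-++ j _ _)

  high : ∀ {zs w ws} → length zs ≡ k → zs ∷ʳ w ≪ ws → ∀ i →
         sortℕ (take (suc k + i) (zs ++ w ∷ ws)) ≡ sortℕ (zs ∷ʳ w) ++ sortℕ (take i ws)
  high {zs} {w} {ws} refl zs≪ws i =
    trans (cong sortℕ (take-suc-length-++ zs w ws i)) (sort-++ _ _ (All.map (All.take⁺ i) zs≪ws))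

  split : P ≼ Q → xs ≼ xs′ × ys ≼ ys′
  split P≼Q =
    (λ j → subst₂ (Pointwise _≤_) (low |xs| j) (low |xs′| j) (P≼Q (j ⊓ k))) ,
    (λ i → Pointwise.++-cancelˡ (sortℕ (xs′ ∷ʳ v′))
             (subst₂ (Pointwise _≤_) (trans (high |xs| xs≪ys i) (cong (_++ _) same))
                                     (high |xs′| xs′≪ys′ i) (P≼Q (suc k + i))))

  join : xs ≼ xs′ × ys ≼ ys′ → P ≼ Q
  join (xs≼xs′ , _) j with j ≤? k
  ... | yes j≤k = subst₂ (Pointwise _≤_) (sym (low-j |xs|)) (sym (low-j |xs′|)) (xs≼xs′ j)
    where
    low-j : ∀ {zs w ws} → length zs ≡ k → sortℕ (take j (zs ++ w ∷ ws)) ≡ sortℕ (take j zs)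
    low-j |zs| = trans (cong (λ n → sortℕ (take n _)) (sym (m≤n⇒m⊓n≡m j≤k))) (low |zs| j)
  join (_ , ys≼ys′) j | no j≰k =
    subst (λ n → Pointwise _≤_ (sortℕ (take n P)) (sortℕ (take n Q))) (m+[n∸m]≡n (≰⇒> j≰k))
      (subst₂ (Pointwise _≤_) (sym (high |xs| xs≪ys i)) (sym (high |xs′| xs′≪ys′ i))
        (Pointwise.++⁺ (subst (Pointwise _≤_ _) same (Pointwise.refl ≤-refl)) (ys≼ys′ i)))
    where
    i : ℕ
    i = j ∸ suc k

-- fromGJW = addIndices suc and gjw = subIndices suc; induction needs the index function general.
addIndices : (ℕ → ℕ) → List ℕ → List ℕ
addIndices f xs = zipWith _+_ xs (applyUpTo f (length xs))

subIndices : (ℕ → ℕ) → List ℕ → List ℕ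
subIndices f xs = zipWith _∸_ xs (applyUpTo f (length xs))

length-addIndices : ∀ f xs → length (addIndices f xs) ≡ length xs
length-addIndices f []       = refl
length-addIndices f (x ∷ xs) = cong suc (length-addIndices (f ∘ suc) xs)

addIndices-subIndices : ∀ f xs → Pointwise _≤_ (applyUpTo f (length xs)) xs →
                        addIndices f (subIndices f xs) ≡ xs
addIndices-subIndices f []       _           = refl
addIndices-subIndices f (x ∷ xs) (fx≤x ∷ le) =
  cong₂ _∷_ (m∸n+n≡m fx≤x) (addIndices-subIndices (f ∘ suc) xs le)

addIndices-++ : ∀ f xs c ys → addIndices f (xs ++ c ∷ ys) ≡
                addIndices f xs ++ (c + f (length xs)) ∷ addIndices (λ i → f (length xs + suc i)) ys
addIndices-++ f []       c ys = refl
addIndices-++ f (x ∷ xs) c ys = cong (x + f 0 ∷_) (addIndices-++ (f ∘ suc) xs c ys)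

addIndices-shift : ∀ d f xs → addIndices (λ i → d + f i) xs ≡ map (d +_) (addIndices f xs)
addIndices-shift d f []       = refl
addIndices-shift d f (x ∷ xs) = cong₂ _∷_ (x∙yz≈y∙xz x d (f 0)) (addIndices-shift d (f ∘ suc) xs)

fromGJW-++ : ∀ xs ys → fromGJW (xs ++ 0 ∷ ys) ≡
             fromGJW xs ++ suc (length xs) ∷ map (suc (length xs) +_) (fromGJW ys)
fromGJW-++ xs ys = trans (addIndices-++ suc xs 0 ys)
  (cong (λ zs → fromGJW xs ++ suc (length xs) ∷ zs) (addIndices-shift (suc (length xs)) suc ys))

module Board (μ ν : List ℕ) (μ≤K : All (_≤ suc (length μ)) μ) where

  K : ℕ
  K = suc (length μ)

  board : List ℕ
  board = μ ++ K ∷ map (K +_) ν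

  record Decomposition (P : List ℕ) : Set where
    field
      lower : Rook μ
      pivot : ℕ
      upper : Rook ν
      pos≡  : P ≡ pos lower ++ pivot ∷ map (K +_) (pos upper)
      fills : pos lower ∷ʳ pivot ↭ oneTo K
  open Decomposition

  first-K-fill : ∀ {xs v ws} → Pointwise 1≤_≤_ xs μ → 1≤ v ≤ K → Unique (xs ++ v ∷ ws) → xs ∷ʳ v ↭ oneTo K
  first-K-fill {xs} {v} {ws} xs-bounds v-bound P! =
    Unique-⊆-length≥⇒↭ _≟_ xs∷ʳv! (oneTo-unique K)
      (∈-oneTo⁺ ∘ All.lookup (All.++⁺ (columns≤ xs-bounds μ≤K) (v-bound ∷ [])))
      (≤-reflexive (begin
        length (oneTo K)     ≡⟨ length-applyUpTo suc K ⟩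
        suc (length μ)       ≡⟨ cong suc (Pointwise-length xs-bounds) ⟨
        suc (length xs)      ≡⟨ +-comm 1 (length xs) ⟩
        length xs + 1        ≡⟨ length-++ xs ⟨
        length (xs ∷ʳ v)     ∎))
    where
    open ≡-Reasoning
    xs∷ʳv! : Unique (xs ∷ʳ v)
    xs∷ʳv! = proj₁ (AllPairs-++⁻ (xs ∷ʳ v) (subst Unique (sym (∷ʳ-++ xs v ws)) P!))

  rest-avoids-first-K : ∀ {xs v ws} → Pointwise 1≤_≤_ xs μ → 1≤ v ≤ K → Unique (xs ++ v ∷ ws) →
                        All (_∉ oneTo K) ws
  rest-avoids-first-K {xs} {v} {ws} xs-bounds v-bound P! =
    Unique-++⇒All∉ (subst Unique (sym (∷ʳ-++ xs v ws)) P!) (first-K-fill xs-bounds v-bound P!)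

  decompose : (x : Rook board) → Decomposition (pos x)
  decompose (rook P P-bounds P!) with Pointwise-++⁻ʳ μ P-bounds
  ... | xs , v ∷ ws , refl , xs-bounds , v-bound ∷ ws-bounds
    with xs! , _ ∷ ws! , _ ← AllPairs-++⁻ xs P!
    with zs , refl , zs-bounds ← shift-down ν (rest-avoids-first-K xs-bounds v-bound P!) ws-bounds
    = record
      { lower = rook xs xs-bounds xs!
      ; pivot = v
      ; upper = rook zs zs-bounds (Unique.map⁻ ws!)
      ; pos≡  = refl
      ; fills = first-K-fill xs-bounds v-bound P!
      }

  first-K≪rest : ∀ {P} (d : Decomposition P) → pos (lower d) ∷ʳ pivot d ≪ map (K +_) (pos (upper d))
  first-K≪rest d = ≤-<⇒≪ (All.tabulate (proj₂ ∘ ∈-oneTo⁻ ∘ ∈-resp-↭ (fills d)))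
                         (shift-up-above K (bounds (upper d)))

  decomposition-≡ : ∀ {P Q} (d : Decomposition P) (e : Decomposition Q) →
                    P ≡ Q ⇔ (pos (lower d) ≡ pos (lower e) × pos (upper d) ≡ pos (upper e))
  decomposition-≡ {P} {Q} d e = mk⇔
    (λ P≡Q → pieces-injective K (trans (length-pos (lower d)) (sym (length-pos (lower e))))
                                (trans (sym (pos≡ d)) (trans P≡Q (pos≡ e))))
    (λ (lower≡ , upper≡) → begin
      P                                                      ≡⟨ pos≡ d ⟩
      pos (lower d) ++ pivot d ∷ map (K +_) (pos (upper d))  ≡⟨ cong₂ (λ xs zs → xs ++ pivot d ∷ map (K +_) zs)
                                                                      lower≡ upper≡ ⟩
      pos (lower e) ++ pivot d ∷ map (K +_) (pos (upper e))  ≡⟨ cong (λ v → pos (lower e) ++ v ∷ _)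
                                                                     (pivot-determined lower≡) ⟩
      pos (lower e) ++ pivot e ∷ map (K +_) (pos (upper e))  ≡⟨ pos≡ e ⟨
      Q                                                      ∎)
    where
    open ≡-Reasoning
    pivot-determined : pos (lower d) ≡ pos (lower e) → pivot d ≡ pivot e
    pivot-determined lower≡ = ∷ʳ-↭-injectiveʳ (pos (lower e))
      (↭-trans (subst (λ xs → xs ∷ʳ pivot d ↭ oneTo K) lower≡ (fills d)) (↭-sym (fills e)))

  decomposition-≼ : ∀ {P Q} (d : Decomposition P) (e : Decomposition Q) →
                    P ≼ Q ⇔ (pos (lower d) ≼ pos (lower e) × pos (upper d) ≼ pos (upper e))
  decomposition-≼ d e =
    subst₂ (λ P′ Q′ → P′ ≼ Q′ ⇔ (pos (lower d) ≼ pos (lower e) × pos (upper d) ≼ pos (upper e)))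
      (sym (pos≡ d)) (sym (pos≡ e))
      ((⇔-id _ ×-⇔ ≼-map (+-monoʳ-≤ K) (+-cancelˡ-≤ K _ _))
        ⇔-∘ ≼-split (length-pos (lower d)) (length-pos (lower e))
                    (trans (first-K-sorted d) (sym (first-K-sorted e)))
                    (first-K≪rest d) (first-K≪rest e))
    where
    first-K-sorted : ∀ {R} (d : Decomposition R) → sortℕ (pos (lower d) ∷ʳ pivot d) ≡ oneTo K
    first-K-sorted d = sorted-↭⇒sort≡ (oneTo-sorted K) (fills d)

  free-column : (r : Rook μ) → ∃ λ w → w ∈ oneTo K × w ∉ pos r
  free-column r = length<⇒∃∉ _≟_ (oneTo-unique K) (begin-strict
    length (pos r)   ≡⟨ length-pos r ⟩
    length μ         <⟨ n<1+n (length μ) ⟩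
    K                ≡⟨ length-applyUpTo suc K ⟨
    length (oneTo K) ∎)
    where open ≤-Reasoning

  glue : Rook μ → Rook ν → Rook board
  glue r s = rook (pos r ++ w ∷ map (K +_) (pos s))
    (Pointwise.++⁺ (bounds r) (∈-oneTo⁻ w∈ ∷ shift-up K (bounds s)))
    (Unique.++⁺ (distinct r) (All.map (<⇒≢ ∘ ≤-<-trans w≤K) s>K ∷ Unique.map⁺ (+-cancelˡ-≡ K _ _) (distinct s))
                disjoint)
    where
    w : ℕ
    w = proj₁ (free-column r)
    w∈ : w ∈ oneTo K
    w∈ = proj₁ (proj₂ (free-column r))
    w∉r : w ∉ pos r
    w∉r = proj₂ (proj₂ (free-column r))
    w≤K : w ≤ K
    w≤K = proj₂ (∈-oneTo⁻ w∈)
    r≤K : All (_≤ K) (pos r)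
    r≤K = All.map proj₂ (columns≤ (bounds r) μ≤K)
    s>K : All (K <_) (map (K +_) (pos s))
    s>K = shift-up-above K (bounds s)
    disjoint : Disjoint (pos r) (w ∷ map (K +_) (pos s))
    disjoint (x∈r , here refl) = w∉r x∈r
    disjoint (x∈r , there x∈s) = <⇒≱ (All.lookup s>K x∈s) (All.lookup r≤K x∈r)

  split : Rook board → Rook μ × Rook ν
  split x = lower (decompose x) , upper (decompose x)

  split-surjective : ∀ (rs : Rook μ × Rook ν) → ∃ λ x → ∀ {z} → pos z ≡ pos x →
                     pos (lower (decompose z)) ≡ pos (proj₁ rs) × pos (upper (decompose z)) ≡ pos (proj₂ rs)
  split-surjective (r , s) = glue r s , λ {z} z≡glue →
    pieces-injective K (trans (length-pos (lower (decompose z))) (sym (length-pos r)))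
                       (trans (sym (pos≡ (decompose z))) z≡glue)

  rookIsoProduct : RookIsoProduct board μ ν
  rookIsoProduct = split , record
    { isOrderMonomorphism = record
      { isOrderHomomorphism = record
        { cong = λ {x y} → to (decomposition-≡ (decompose x) (decompose y))
        ; mono = λ {x y} → to (decomposition-≼ (decompose x) (decompose y))
        }
      ; injective = λ {x y} → from (decomposition-≡ (decompose x) (decompose y))
      ; cancel    = λ {x y} → from (decomposition-≼ (decompose x) (decompose y))
      }
    ; surjective = split-surjective
    }

mainTheorem4 : (lam : List ℕ) → IsPartition lam →
    (a b : List ℕ) → gjw lam ≡ a ++ (0 ∷ b) →
    RookIsoProduct lam (fromGJW a) (fromGJW b)
mainTheorem4 lam (lam↗ , lam≥index) a b gjw≡ =
  subst (λ P → RookIsoProduct P μ ν) (sym lam≡board) (Board.rookIsoProduct μ ν μ≤K)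
  where
  open ≡-Reasoning
  μ ν : List ℕ
  μ = fromGJW a
  ν = fromGJW b
  lam≡board : lam ≡ μ ++ suc (length μ) ∷ map (suc (length μ) +_) ν
  lam≡board = begin
    lam                                          ≡⟨ addIndices-subIndices suc lam lam≥index ⟨
    fromGJW (gjw lam)                            ≡⟨ cong fromGJW gjw≡ ⟩
    fromGJW (a ++ 0 ∷ b)                         ≡⟨ fromGJW-++ a b ⟩
    μ ++ suc (length a) ∷ map (suc (length a) +_) ν
      ≡⟨ cong (λ n → μ ++ suc n ∷ map (suc n +_) ν) (length-addIndices suc a) ⟨
    μ ++ suc (length μ) ∷ map (suc (length μ) +_) ν ∎
  μ≤K : All (_≤ suc (length μ)) μ
  μ≤K = Linked-++-∷⇒All≤ μ (subst (Linked _≤_) lam≡board lam↗)
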